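{- Let $p$ be an odd prime, let $m$ be an integer not divisible by $p$, and let $\varepsilon\in\{1,-1\}$. Let $\mathcal A_{p,m,\varepsilon}$ be the set of residue classes $n \bmod p(p-1)$ such that $p^2\mid D_\varepsilon(n,m)$, and let $\mathcal B_{p,m,\varepsilon}$ be the set of ordered pairs $(x \bmod p^2,\ k \bmod p-1)$ such that $x$ is a nonzero $p$th power modulo $p^2$ and $x^k\equiv -\varepsilon(1-x)^m\pmod{p^2}$. Define $\alpha_{p,m,\varepsilon}:\mathcal A_{p,m,\varepsilon}\to\mathcal B_{p,m,\varepsilon}$ by sending $n \bmod p(p-1)$ to the pair consisting of the unique $p$th power $x \bmod p^2$ with $x\equiv 1-mn^{ -1}\pmod p$ and of $m-n \bmod p-1$, and define $\beta_{p,m,\varepsilon}:\mathcal B_{p,m,\varepsilon}\to\mathcal A_{p,m,\varepsilon}$ by $\beta_{p,m,\varepsilon}(x,k)=(m-k)p-m(1-x)^{ -1}(p-1) \bmod p(p-1)$, where $(1-x)^{ -1}$ is an integer inverse of $1-x$ modulo $p^2$. Then these maps are well defined and are mutually inverse bijections; in particular $\mathcal A_{p,m,\varepsilon}$ and $\mathcal B_{p,m,\varepsilon}$ are in one-to-one correspondence.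
   Context: For $\varepsilon\in\{ -1,1\}$ and positive integers $n>m$, $D_\varepsilon(n,m)=n^n+\varepsilon (n-m)^{n-m}m^m$. Convention: for a prime $p$ and integers $n,m$ with $p\nmid m$ (not necessarily positive or with $n>m$), "$p^2\mid D_\varepsilon(n,m)$" means $p^2\mid D_\varepsilon(n',m')$ for positive integers $m'\equiv m$, $n'\equiv n \pmod{p(p-1)}$ with $n'>m'$ (this does not depend on the choice of $n',m'$). An integer $x$ is a nonzero $p$th power modulo $p^2$ if $x\equiv a^p\pmod{p^2}$ for some integer $a$ and $p\nmid x$. Powers with negative exponents denote powers of inverses modulo $p^2$. -}

module Defs where

open import Data.Nat.Base as ℕ using (ℕ; suc)
open import Data.Integer.Base using (ℤ; +_; -[1+_]; _+_; _-_; _*_; -_; _^_; _<_)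
open import Data.Integer.Divisibility using (_∣_)
open import Data.Product using (Σ; ∃; ∃-syntax; _×_)
open import Data.Sum using (_⊎_)
open import Relation.Binary.PropositionalEquality using (_≡_)
open import Relation.Nullary using (¬_)

infix 4 _≡_[mod_]

_≡_[mod_] : ℤ → ℤ → ℕ → Set
a ≡ b [mod N ] = (+ N) ∣ (a - b)

-- D_ε(n,m) = n^n + ε (n-m)^(n-m) m^m  for natural n > m > 0 (ε an integer, ±1)
D : ℤ → ℕ → ℕ → ℤ
D ε n m = + (n ℕ.^ n) + ε * + ((n ℕ.∸ m) ℕ.^ (n ℕ.∸ m) ℕ.* m ℕ.^ m)

-- Convention of the paper: for integers n, m (p ∤ m), "p² ∣ D_ε(n,m)" means
-- p² ∣ D_ε(n',m') for positive integers m' ≡ m, n' ≡ n (mod p(p-1)) with n' > m'.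
-- (Independent of the choice of n', m'; we use the existential form.)
P²DivD : ℕ → ℤ → ℤ → ℤ → Set
P²DivD p ε n m =
  ∃[ n' ] ∃[ m' ] (0 ℕ.< m' × m' ℕ.< n' ×
    (+ n' ≡ n [mod p ℕ.* (p ℕ.∸ 1)]) × (+ m' ≡ m [mod p ℕ.* (p ℕ.∸ 1)]) ×
    (+ (p ℕ.* p) ∣ D ε n' m'))

-- "x^k ≡ r (mod N)" for an integer exponent k; a negative exponent means a
-- power of an inverse of x modulo N (false if x has no inverse modulo N).
PowMod : ℕ → ℤ → ℤ → ℤ → Set
PowMod N x (+ k) r = x ^ k ≡ r [mod N ]
PowMod N x -[1+ k ] r = ∃[ u ] ((u * x ≡ + 1 [mod N ]) × (u ^ suc k ≡ r [mod N ]))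

NonzeroPthPower : ℕ → ℤ → Set
NonzeroPthPower p x = (¬ (+ p ∣ x)) × ∃[ a ] (x ≡ a ^ p [mod p ℕ.* p ])

InA : ℕ → ℤ → ℤ → ℤ → Set
InA p m ε n = P²DivD p ε n m

InB : ℕ → ℤ → ℤ → ℤ → ℤ → Set
InB p m ε x k = NonzeroPthPower p x ×
  ∃[ r ] ∃[ s ] (PowMod (p ℕ.* p) x k r × PowMod (p ℕ.* p) (+ 1 - x) m s ×
                 (r ≡ - ε * s [mod p ℕ.* p ]))

AlphaGraph : ℕ → ℤ → ℤ → ℤ → ℤ → Set
AlphaGraph p m n x k =
  NonzeroPthPower p x ×
  ∃[ v ] ((v * n ≡ + 1 [mod p ]) × (x ≡ + 1 - m * v [mod p ])) ×
  (k ≡ m - n [mod p ℕ.∸ 1 ])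

BetaGraph : ℕ → ℤ → ℤ → ℤ → ℤ → Set
BetaGraph p m x k n =
  ∃[ u ] ((u * (+ 1 - x) ≡ + 1 [mod p ℕ.* p ]) ×
          (n ≡ (m - k) * + p - m * u * + (p ℕ.∸ 1) [mod p ℕ.* (p ℕ.∸ 1) ]))

-- Take representatives n ≡ N, m ≡ B (mod p(p-1)) with N > B > 0 and put A = N - B.  If x ≡ A/N (mod p),
-- then (A + B) x ≡ A is exactly the critical point of y ↦ y^A (1-y)^B, so this function
-- is constant modulo p² on the residue class of x modulo p, and
--   D_ε(N, B) = N^N + ε A^A B^B ≡ N^N (1 + ε x^A (1-x)^B)  (mod p²).
-- Hence p² ∣ D_ε exactly when x^A (1-x)^B ≡ -ε, which for the p-th power lift x (whose
-- order divides p - 1) reads x^(m-n) ≡ -ε (1-x)^m.  The inverse β is the Chinese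
-- remainder solution of n ≡ m (1-x)⁻¹ (mod p) and n ≡ m - k (mod p - 1).  Fermat's little
-- theorem and the lift a ≡ b (mod p) ⇒ a^p ≡ b^p (mod p²) supply the arithmetic mod p².

module Submission where

open import Defs
open import Data.Empty using (⊥-elim)
open import Data.Integer.Base hiding (suc)
import Data.Integer.Properties
open import Algebra.Properties.CommutativeSemigroup Data.Integer.Properties.*-commutativeSemigroup using (x∙yz≈y∙xz)
open import Data.Integer.Properties using (pos-+; pos-*; abs-*; +-injective; +-identityˡ; +-identityʳ; +-inverseˡ; +-inverseʳ; *-identityˡ; *-identityʳ; *-zeroˡ; *-zeroʳ; *-assoc; *-comm; neg-involutive; neg-distribˡ-*; neg-distribʳ-*; ^-zeroˡ; ^-*-assoc; ^-distribˡ-+-*)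
open import Data.Integer.DivMod using (a≡a%ℕn+[a/ℕn]*n; n%ℕd<d)
open import Data.Integer.Divisibility using (_∣_)
import Data.Integer.Divisibility.Signed as Signed
open import Data.Integer.Tactic.RingSolver using (solve-∀)
open import Data.Nat.Base as ℕ using (ℕ; zero; suc; _!; nonTrivial⇒n>1)
open import Data.Nat.Combinatorics using (_C_; nCk≡n!/k![n-k]!; k![n∸k]!∣n!; nCk+nC[k+1]≡[n+1]C[k+1]; nCn≡1; k>n⇒nCk≡0)
import Data.Nat.Divisibility as ℕ
open import Data.Nat.DivMod using (m/n*n≡m)
open import Data.Nat.Primality using (Prime; euclidsLemma; prime⇒nonTrivial)
import Data.Nat.Properties as ℕ
open import Data.Product using (_,_; _×_; ∃-syntax)
open import Data.Sum using (_⊎_; inj₁; inj₂)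
open import Relation.Binary.Bundles using (Setoid)
open import Relation.Binary.PropositionalEquality
import Relation.Binary.Reasoning.Setoid as SetoidReasoning
open import Relation.Nullary using (¬_)

-- Congruences modulo N

infix 4 _≈_[mod_]

record _≈_[mod_] (a b : ℤ) (N : ℕ) : Set where
  constructor ≈-by
  field
    quotient : ℤ
    equality : a ≡ b + quotient * + N

≈⇒≡mod : ∀ {N a b} → a ≈ b [mod N ] → a ≡ b [mod N ]
≈⇒≡mod {N} {a} {b} (≈-by q refl) = Signed.∣⇒∣ᵤ (Signed.divides q (cancel b (q * + N)))
  where
  cancel : ∀ b t → (b + t) - b ≡ t
  cancel = solve-∀

≡mod⇒≈ : ∀ {N} a b → a ≡ b [mod N ] → a ≈ b [mod N ]
≡mod⇒≈ {N} a b h with Signed.∣ᵤ⇒∣ {+ N} {a - b} h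
... | Signed.divides q eq = ≈-by q (trans (split a b) (cong (λ z → b + z) eq))
  where
  split : ∀ a b → a ≡ b + (a - b)
  split = solve-∀

module _ {N : ℕ} where

  ≈-refl : ∀ {a} → a ≈ a [mod N ]
  ≈-refl {a} = ≈-by 0ℤ (sym (trans (cong (λ z → a + z) (*-zeroˡ (+ N))) (+-identityʳ a)))

  ≈-reflexive : ∀ {a b} → a ≡ b → a ≈ b [mod N ]
  ≈-reflexive refl = ≈-refl

  ≈-sym : ∀ {a b} → a ≈ b [mod N ] → b ≈ a [mod N ]
  ≈-sym {b = b} (≈-by q refl) = ≈-by (- q) (back b q (+ N))
    where
    back : ∀ b q n → b ≡ (b + q * n) + (- q) * n
    back = solve-∀

  ≈-trans : ∀ {a b c} → a ≈ b [mod N ] → b ≈ c [mod N ] → a ≈ c [mod N ]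
  ≈-trans {c = c} (≈-by q refl) (≈-by r refl) = ≈-by (q + r) (collect c q r (+ N))
    where
    collect : ∀ c q r n → (c + r * n) + q * n ≡ c + (q + r) * n
    collect = solve-∀

  ≈-setoid : Setoid _ _
  ≈-setoid = record
    { Carrier       = ℤ
    ; _≈_           = _≈_[mod N ]
    ; isEquivalence = record { refl = ≈-refl ; sym = ≈-sym ; trans = ≈-trans }
    }

  +-multiple≈ : ∀ a t → a + t * + N ≈ a [mod N ]
  +-multiple≈ a t = ≈-by t refl

  +-cong : ∀ {a b c d} → a ≈ b [mod N ] → c ≈ d [mod N ] → a + c ≈ b + d [mod N ]
  +-cong {b = b} {d = d} (≈-by q refl) (≈-by r refl) = ≈-by (q + r) (expand b d q r (+ N))
    where
    expand : ∀ b d q r n → (b + q * n) + (d + r * n) ≡ (b + d) + (q + r) * n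
    expand = solve-∀

  *-cong : ∀ {a b c d} → a ≈ b [mod N ] → c ≈ d [mod N ] → a * c ≈ b * d [mod N ]
  *-cong {b = b} {d = d} (≈-by q refl) (≈-by r refl) =
    ≈-by (q * d + b * r + q * r * + N) (expand b d q r (+ N))
    where
    expand : ∀ b d q r n → (b + q * n) * (d + r * n) ≡ b * d + (q * d + b * r + q * r * n) * n
    expand = solve-∀

  neg-cong : ∀ {a b} → a ≈ b [mod N ] → - a ≈ - b [mod N ]
  neg-cong {b = b} (≈-by q refl) = ≈-by (- q) (expand b q (+ N))
    where
    expand : ∀ b q n → - (b + q * n) ≡ - b + (- q) * n
    expand = solve-∀

  +-congˡ : ∀ a {b c} → b ≈ c [mod N ] → a + b ≈ a + c [mod N ]
  +-congˡ a = +-cong (≈-refl {a})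

  +-congʳ : ∀ a {b c} → b ≈ c [mod N ] → b + a ≈ c + a [mod N ]
  +-congʳ a h = +-cong h (≈-refl {a})

  *-congˡ : ∀ a {b c} → b ≈ c [mod N ] → a * b ≈ a * c [mod N ]
  *-congˡ a = *-cong (≈-refl {a})

  *-congʳ : ∀ a {b c} → b ≈ c [mod N ] → b * a ≈ c * a [mod N ]
  *-congʳ a h = *-cong h (≈-refl {a})

  -‿cong : ∀ {a b c d} → a ≈ b [mod N ] → c ≈ d [mod N ] → a - c ≈ b - d [mod N ]
  -‿cong h h′ = +-cong h (neg-cong h′)

  -‿congˡ : ∀ a {b c} → b ≈ c [mod N ] → a - b ≈ a - c [mod N ]
  -‿congˡ a = -‿cong (≈-refl {a})

  ^-cong : ∀ {a b} e → a ≈ b [mod N ] → a ^ e ≈ b ^ e [mod N ]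
  ^-cong zero    h = ≈-refl
  ^-cong (suc e) h = *-cong h (^-cong e h)

  ≈⇒-≈0 : ∀ {a b} → a ≈ b [mod N ] → a - b ≈ 0ℤ [mod N ]
  ≈⇒-≈0 {b = b} h = ≈-trans (-‿cong h (≈-refl {b})) (≈-reflexive (+-inverseʳ b))

  -≈0⇒≈ : ∀ {a b} → a - b ≈ 0ℤ [mod N ] → a ≈ b [mod N ]
  -≈0⇒≈ {a} {b} (≈-by q eq) = ≈-by q (trans (split a b) (cong (λ z → b + z) (trans eq (+-identityˡ _))))
    where
    split : ∀ a b → a ≡ b + (a - b)
    split = solve-∀

  ≈0⇒∣ : ∀ {a} → a ≈ 0ℤ [mod N ] → N ℕ.∣ ∣ a ∣
  ≈0⇒∣ (≈-by q refl) = ℕ.divides ∣ q ∣ (trans (cong ∣_∣ (+-identityˡ (q * + N))) (abs-* q (+ N)))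

  ∣⇒≈0 : ∀ {a} → N ℕ.∣ ∣ a ∣ → a ≈ 0ℤ [mod N ]
  ∣⇒≈0 {a} h = ≡mod⇒≈ a 0ℤ (subst (λ z → N ℕ.∣ ∣ z ∣) (sym (+-identityʳ a)) h)

module ≈-Reasoning {N : ℕ} = SetoidReasoning (≈-setoid {N})

≈-weakenˡ : ∀ {a b} d e → a ≈ b [mod d ℕ.* e ] → a ≈ b [mod d ]
≈-weakenˡ {b = b} d e (≈-by q refl) =
  ≈-by (q * + e) (trans (cong (λ z → b + q * z) (pos-* d e)) (regroup b q (+ d) (+ e)))
  where
  regroup : ∀ b q d e → b + q * (d * e) ≡ b + (q * e) * d
  regroup = solve-∀

≈-weakenʳ : ∀ {a b} d e → a ≈ b [mod d ℕ.* e ] → a ≈ b [mod e ]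
≈-weakenʳ {b = b} d e (≈-by q refl) =
  ≈-by (q * + d) (trans (cong (λ z → b + q * z) (pos-* d e)) (regroup b q (+ d) (+ e)))
  where
  regroup : ∀ b q d e → b + q * (d * e) ≡ b + (q * d) * e
  regroup = solve-∀

-- d = (1 + n) d - n d: the moduli 1 + n and n are coprime.
≈-combine : ∀ {a b} n → a ≈ b [mod suc n ] → a ≈ b [mod n ] → a ≈ b [mod suc n ℕ.* n ]
≈-combine {a} {b} n h h′ with ≈⇒-≈0 h | ≈⇒-≈0 h′
... | ≈-by s e | ≈-by t e′ = -≈0⇒≈ (≈-by (t - s)
  (trans (combine (a - b) s t (+ n) (trans e (+-identityˡ _)) (trans e′ (+-identityˡ _)))
         (cong (λ z → 0ℤ + (t - s) * z) (sym (pos-* (suc n) n)))))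
  where
  combine : ∀ d s t q → d ≡ s * (1ℤ + q) → d ≡ t * q → d ≡ 0ℤ + (t - s) * ((1ℤ + q) * q)
  combine d s t q e e′ = trans (split d q) (trans (cong₂ (λ u v → u * (1ℤ + q) - v * q) e′ e) (collect s t q))
    where
    split : ∀ d q → d ≡ d * (1ℤ + q) - d * q
    split = solve-∀
    collect : ∀ s t q → t * q * (1ℤ + q) - s * (1ℤ + q) * q ≡ 0ℤ + (t - s) * ((1ℤ + q) * q)
    collect = solve-∀

%ℕ≈ : ∀ a N .{{_ : ℕ.NonZero N}} → + (a %ℕ N) ≈ a [mod N ]
%ℕ≈ a N = ≈-sym (≈-by (a /ℕ N) (a≡a%ℕn+[a/ℕn]*n a N))

inverse⇒cancelˡ : ∀ {N a u x y} → u * a ≈ 1ℤ [mod N ] → a * x ≈ a * y [mod N ] → x ≈ y [mod N ]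
inverse⇒cancelˡ {N} {a} {u} {x} {y} ua≈1 ax≈ay = begin
  x              ≡⟨ *-identityˡ x ⟨
  1ℤ * x         ≈⟨ *-congʳ x ua≈1 ⟨
  u * a * x      ≡⟨ *-assoc u a x ⟩
  u * (a * x)    ≈⟨ *-congˡ u ax≈ay ⟩
  u * (a * y)    ≡⟨ *-assoc u a y ⟨
  u * a * y      ≈⟨ *-congʳ y ua≈1 ⟩
  1ℤ * y         ≡⟨ *-identityˡ y ⟩
  y              ∎
  where open ≈-Reasoning

≈0⇒^≈0 : ∀ {N a} e → a ≈ 0ℤ [mod N ] → a ^ suc (suc e) ≈ 0ℤ [mod N ℕ.* N ]
≈0⇒^≈0 {N} e (≈-by t refl) = ≈-by (t * t * (0ℤ + t * + N) ^ e)
  (trans (square t (+ N) ((0ℤ + t * + N) ^ e)) (cong (λ u → 0ℤ + t * t * (0ℤ + t * + N) ^ e * u) (sym (pos-* N N))))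
  where
  square : ∀ t n c → (0ℤ + t * n) * ((0ℤ + t * n) * c) ≡ 0ℤ + t * t * c * (n * n)
  square = solve-∀

module Sign {ε : ℤ} (ε² : ε * ε ≡ 1ℤ) where

  1+ε*≈0⇒≈-ε : ∀ {N g} → 1ℤ + ε * g ≈ 0ℤ [mod N ] → g ≈ - ε [mod N ]
  1+ε*≈0⇒≈-ε {N} {g} h = begin
    g                       ≡⟨ *-identityˡ g ⟨
    1ℤ * g                  ≡⟨ cong (_* g) ε² ⟨
    ε * ε * g               ≡⟨ rearrange ε g ⟩
    ε * (1ℤ + ε * g) - ε    ≈⟨ +-congʳ (- ε) (*-congˡ ε h) ⟩
    ε * 0ℤ - ε              ≡⟨ cong (_- ε) (*-zeroʳ ε) ⟩
    0ℤ - ε                  ≡⟨ +-identityˡ (- ε) ⟩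
    - ε                     ∎
    where
    open ≈-Reasoning
    rearrange : ∀ ε g → ε * ε * g ≡ ε * (1ℤ + ε * g) - ε
    rearrange = solve-∀

  ≈-ε⇒1+ε*≈0 : ∀ {N g} → g ≈ - ε [mod N ] → 1ℤ + ε * g ≈ 0ℤ [mod N ]
  ≈-ε⇒1+ε*≈0 {N} {g} h = begin
    1ℤ + ε * g          ≈⟨ +-congˡ 1ℤ (*-congˡ ε h) ⟩
    1ℤ + ε * - ε        ≡⟨ cong (λ u → 1ℤ + u) (neg-distribʳ-* ε ε) ⟨
    1ℤ - ε * ε          ≡⟨ cong (λ u → 1ℤ - u) ε² ⟩
    1ℤ - 1ℤ             ≡⟨⟩
    0ℤ                  ∎
    where open ≈-Reasoning

  -ε²≡1 : - ε * - ε ≡ 1ℤ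
  -ε²≡1 = trans (sym (neg-distribˡ-* ε (- ε))) (trans (cong -_ (sym (neg-distribʳ-* ε ε))) (trans (neg-involutive (ε * ε)) ε²))

±1² : ∀ {ε} → ε ≡ 1ℤ ⊎ ε ≡ -1ℤ → ε * ε ≡ 1ℤ
±1² (inj₁ refl) = refl
±1² (inj₂ refl) = refl

-- Expansions of powers

^-distribʳ-* : ∀ a b n → (a * b) ^ n ≡ a ^ n * b ^ n
^-distribʳ-* a b zero    = refl
^-distribʳ-* a b (suc n) = trans (cong ((a * b) *_) (^-distribʳ-* a b n)) (swap a b (a ^ n) (b ^ n))
  where
  swap : ∀ a b x y → (a * b) * (x * y) ≡ (a * x) * (b * y)
  swap = solve-∀

binomialSum : ℕ → ℤ → ℕ → ℤ
binomialSum n x zero    = 0ℤ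
binomialSum n x (suc j) = binomialSum n x j + + (n C j) * x ^ j

binomialSum-suc : ∀ n x j → binomialSum (suc n) x (suc j) ≡ binomialSum n x (suc j) + x * binomialSum n x j
binomialSum-suc n x zero    = base x
  where
  base : ∀ x → 0ℤ + 1ℤ * 1ℤ ≡ (0ℤ + 1ℤ * 1ℤ) + x * 0ℤ
  base = solve-∀
binomialSum-suc n x (suc j) = begin
  binomialSum (suc n) x (suc j) + + (suc n C suc j) * x ^ suc j
    ≡⟨ cong₂ (λ u v → u + + v * x ^ suc j) (binomialSum-suc n x j) (sym (nCk+nC[k+1]≡[n+1]C[k+1] n j)) ⟩
  (B₁ + x * B₀) + + (n C j ℕ.+ n C suc j) * (x * x ^ j)
    ≡⟨ cong (λ u → (B₁ + x * B₀) + u * (x * x ^ j)) (pos-+ (n C j) (n C suc j)) ⟩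
  (B₁ + x * B₀) + (+ (n C j) + + (n C suc j)) * (x * x ^ j)
    ≡⟨ regroup B₁ B₀ (+ (n C j)) (+ (n C suc j)) x (x ^ j) ⟩
  (B₁ + + (n C suc j) * (x * x ^ j)) + x * (B₀ + + (n C j) * x ^ j) ∎
  where
  open ≡-Reasoning
  B₀ = binomialSum n x j
  B₁ = binomialSum n x (suc j)
  regroup : ∀ B₁ B₀ c c′ x y → (B₁ + x * B₀) + (c + c′) * (x * y) ≡ (B₁ + c′ * (x * y)) + x * (B₀ + c * y)
  regroup = solve-∀

binomial-theorem : ∀ n x → (x + 1ℤ) ^ n ≡ binomialSum n x (suc n)
binomial-theorem zero    x = refl
binomial-theorem (suc n) x = begin
  (x + 1ℤ) * (x + 1ℤ) ^ n                             ≡⟨ cong ((x + 1ℤ) *_) (binomial-theorem n x) ⟩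
  (x + 1ℤ) * B                                        ≡⟨ distrib B x (x ^ suc n) ⟩
  (B + 0ℤ * x ^ suc n) + x * B                        ≡⟨ cong (λ c → (B + + c * x ^ suc n) + x * B) nC[n+1]≡0 ⟨
  binomialSum n x (suc (suc n)) + x * B               ≡⟨ binomialSum-suc n x (suc n) ⟨
  binomialSum (suc n) x (suc (suc n))                 ∎
  where
  open ≡-Reasoning
  B = binomialSum n x (suc n)
  nC[n+1]≡0 : n C suc n ≡ 0
  nC[n+1]≡0 = k>n⇒nCk≡0 (ℕ.n<1+n n)
  distrib : ∀ B x y → (x + 1ℤ) * B ≡ (B + 0ℤ * y) + x * B
  distrib = solve-∀

taylor : ∀ y d e → ∃[ Q ] ((y + d) ^ suc e ≡ y ^ suc e + + suc e * y ^ e * d + Q * (d * d))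
taylor y d zero    = 0ℤ , linear y d
  where
  linear : ∀ y d → (y + d) * 1ℤ ≡ y * 1ℤ + 1ℤ * 1ℤ * d + 0ℤ * (d * d)
  linear = solve-∀
taylor y d (suc e) with taylor y d e
... | Q , eq = y * Q + + suc e * y ^ e + d * Q , trans (cong ((y + d) *_) eq) (step y d Q (y ^ e) (+ suc e))
  where
  step : ∀ y d Q yᵉ c → (y + d) * (y * yᵉ + c * yᵉ * d + Q * (d * d))
                       ≡ y * (y * yᵉ) + (1ℤ + c) * (y * yᵉ) * d + (y * Q + c * yᵉ + d * Q) * (d * d)
  step = solve-∀

taylor-mod : ∀ N y t e → (y + t * + N) ^ suc e ≈ y ^ suc e + + suc e * y ^ e * (t * + N) [mod N ℕ.* N ]
taylor-mod N y t e with taylor y (t * + N) e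
... | Q , eq = ≈-by (Q * t * t) (trans eq (cong (λ z → y ^ suc e + + suc e * y ^ e * (t * + N) + z)
                 (trans (regroup Q t (+ N)) (cong ((Q * t * t) *_) (sym (pos-* N N))))))
  where
  regroup : ∀ Q t n → Q * ((t * n) * (t * n)) ≡ (Q * t * t) * (n * n)
  regroup = solve-∀

-- The linear term N · a^(N-1) · tN of (a + tN)^N is itself divisible by N².
^-lift : ∀ N {a b} → a ≈ b [mod N ] → a ^ N ≈ b ^ N [mod N ℕ.* N ]
^-lift zero    _         = ≈-refl
^-lift (suc n) {a} {b} h with ≈-sym h
... | ≈-by t refl = ≈-sym (≈-trans (taylor-mod (suc n) a t n)
        (≈-by (a ^ n * t) (trans (regroup (a ^ suc n) (a ^ n) t (+ suc n))
                                 (cong (λ z → a ^ suc n + (a ^ n * t) * z) (sym (pos-* (suc n) (suc n)))))))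
  where
  regroup : ∀ b X t n → b + n * X * (t * n) ≡ b + (X * t) * (n * n)
  regroup = solve-∀

-- For A = a + 1, B = b + 1 the derivative A y^a (1-y)^B - B y^A (1-y)^b of y^A (1-y)^B
-- vanishes modulo N where (A + B) y ≡ A, so the function is constant modulo N² on that class.
critical-point : ∀ N a b {y z} → (+ suc a + + suc b) * y ≈ + suc a [mod N ] → z ≈ y [mod N ] →
                 z ^ suc a * (1ℤ - z) ^ suc b ≈ y ^ suc a * (1ℤ - y) ^ suc b [mod N ℕ.* N ]
critical-point N a b {y} (≈-by s es) (≈-by t refl) = begin
  (y + t * n) ^ suc a * (1ℤ - (y + t * n)) ^ suc b
    ≡⟨ cong (λ u → (y + t * n) ^ suc a * u ^ suc b) (shift y t n) ⟩
  (y + t * n) ^ suc a * ((1ℤ - y) + (- t) * n) ^ suc b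
    ≈⟨ *-cong (taylor-mod N y t a) (taylor-mod N (1ℤ - y) (- t) b) ⟩
  (y * yᵃ + A * yᵃ * (t * n)) * ((1ℤ - y) * wᵇ + B * wᵇ * ((- t) * n))
    ≡⟨ expand y yᵃ wᵇ A B t n ⟩
  Y * W + t * n * yᵃ * wᵇ * (A - (A + B) * y) - A * B * yᵃ * wᵇ * t * t * (n * n)
    ≡⟨ cong (λ u → Y * W + t * n * yᵃ * wᵇ * (A - u) - A * B * yᵃ * wᵇ * t * t * (n * n)) es ⟩
  Y * W + t * n * yᵃ * wᵇ * (A - (A + s * n)) - A * B * yᵃ * wᵇ * t * t * (n * n)
    ≡⟨ collect Y W yᵃ wᵇ A B t s n ⟩
  Y * W + Q * (n * n)
    ≡⟨ cong (λ u → Y * W + Q * u) (pos-* N N) ⟨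
  Y * W + Q * + (N ℕ.* N)
    ≈⟨ +-multiple≈ (Y * W) Q ⟩
  Y * W ∎
  where
  open ≈-Reasoning
  n  = + N
  yᵃ = y ^ a
  wᵇ = (1ℤ - y) ^ b
  A  = + suc a
  B  = + suc b
  Y  = y * yᵃ
  W  = (1ℤ - y) * wᵇ
  Q  = - (t * s * yᵃ * wᵇ) - A * B * yᵃ * wᵇ * t * t
  shift : ∀ y t n → 1ℤ - (y + t * n) ≡ (1ℤ - y) + (- t) * n
  shift = solve-∀
  expand : ∀ y yᵃ wᵇ A B t n →
    (y * yᵃ + A * yᵃ * (t * n)) * ((1ℤ - y) * wᵇ + B * wᵇ * ((- t) * n))
    ≡ (y * yᵃ) * ((1ℤ - y) * wᵇ) + t * n * yᵃ * wᵇ * (A - (A + B) * y) - A * B * yᵃ * wᵇ * t * t * (n * n)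
  expand = solve-∀
  collect : ∀ Y W yᵃ wᵇ A B t s n →
    Y * W + t * n * yᵃ * wᵇ * (A - (A + s * n)) - A * B * yᵃ * wᵇ * t * t * (n * n)
    ≡ Y * W + (- (t * s * yᵃ * wᵇ) - A * B * yᵃ * wᵇ * t * t) * (n * n)
  collect = solve-∀

-- Positive representatives and D

pos-^ : ∀ x e → + (x ℕ.^ e) ≡ (+ x) ^ e
pos-^ x zero    = refl
pos-^ x (suc e) = trans (pos-* x (x ℕ.^ e)) (cong (λ u → + x * u) (pos-^ x e))

D-pos : ∀ ε a b → D ε (suc a ℕ.+ suc b) (suc b) ≡
        (+ (suc a ℕ.+ suc b)) ^ (suc a ℕ.+ suc b) + ε * ((+ suc a) ^ suc a * (+ suc b) ^ suc b)
D-pos ε a b = begin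
  D ε n (suc b)
    ≡⟨ cong (λ u → + (n ℕ.^ n) + ε * + (u ℕ.^ u ℕ.* suc b ℕ.^ suc b)) (ℕ.m+n∸n≡m (suc a) (suc b)) ⟩
  + (n ℕ.^ n) + ε * + (suc a ℕ.^ suc a ℕ.* suc b ℕ.^ suc b)
    ≡⟨ cong (λ u → + (n ℕ.^ n) + ε * u) (pos-* (suc a ℕ.^ suc a) (suc b ℕ.^ suc b)) ⟩
  + (n ℕ.^ n) + ε * (+ (suc a ℕ.^ suc a) * + (suc b ℕ.^ suc b))
    ≡⟨ cong₂ (λ u v → u + ε * v) (pos-^ n n) (cong₂ _*_ (pos-^ (suc a) (suc a)) (pos-^ (suc b) (suc b))) ⟩
  (+ n) ^ n + ε * ((+ suc a) ^ suc a * (+ suc b) ^ suc b) ∎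
  where
  open ≡-Reasoning
  n = suc a ℕ.+ suc b

positive-split : ∀ {M N} → 0 ℕ.< M → M ℕ.< N → ∃[ a ] ∃[ b ] (M ≡ suc b × N ≡ suc a ℕ.+ suc b)
positive-split {suc b} _ b<N with ℕ.m≤n⇒∃[o]m+o≡n b<N
... | a , eq = a , b , refl , trans (sym eq) (cong suc (ℕ.+-comm (suc b) a))

-- Arithmetic modulo a prime p and modulo p²

module ModPrime (k : ℕ) (p-prime : Prime (suc (suc k))) where

  p : ℕ
  p = suc (suc k)

  prime∤! : ∀ {j} → j ℕ.< p → ¬ p ℕ.∣ j !
  prime∤! {zero}  _   p∣1 = ℕ.<⇒≱ (ℕ.s≤s (ℕ.s≤s ℕ.z≤n)) (ℕ.∣⇒≤ p∣1)
  prime∤! {suc j} j<p p∣j! with euclidsLemma (suc j) (j !) p-prime p∣j!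
  ... | inj₁ p∣j = ℕ.<⇒≱ j<p (ℕ.∣⇒≤ p∣j)
  ... | inj₂ p∣j! = prime∤! (ℕ.<⇒≤ j<p) p∣j!

  prime∣C : ∀ {j} → 0 ℕ.< j → j ℕ.< p → p ℕ.∣ p C j
  prime∣C {j} 0<j j<p with euclidsLemma (p C j) (j ! ℕ.* (p ℕ.∸ j) !) p-prime p∣C*fact
    where
    instance _ = j ℕ.!* (p ℕ.∸ j) !≢0
    p∣C*fact : p ℕ.∣ (p C j) ℕ.* (j ! ℕ.* (p ℕ.∸ j) !)
    p∣C*fact = subst (p ℕ.∣_)
      (sym (trans (cong (λ c → c ℕ.* (j ! ℕ.* (p ℕ.∸ j) !)) (nCk≡n!/k![n-k]! (ℕ.<⇒≤ j<p))) (m/n*n≡m (k![n∸k]!∣n! (ℕ.<⇒≤ j<p)))))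
      (ℕ.m∣m*n ((suc k) !))
  ... | inj₁ p∣C = p∣C
  ... | inj₂ p∣fact with euclidsLemma (j !) ((p ℕ.∸ j) !) p-prime p∣fact
  ...   | inj₁ p∣j! = ⊥-elim (prime∤! j<p p∣j!)
  ...   | inj₂ p∣[p-j]! = ⊥-elim (prime∤! (ℕ.∸-monoʳ-< 0<j (ℕ.<⇒≤ j<p)) p∣[p-j]!)

  Unit : ℤ → Set
  Unit a = ¬ a ≈ 0ℤ [mod p ]

  ∣⇒Unit : ∀ {a} → ¬ (+ p ∣ a) → Unit a
  ∣⇒Unit p∤a a≈0 = p∤a (≈0⇒∣ a≈0)

  Unit⇒∣ : ∀ {a} → Unit a → ¬ (+ p ∣ a)
  Unit⇒∣ unit p∣a = unit (∣⇒≈0 p∣a)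

  euclid : ∀ a b → a * b ≈ 0ℤ [mod p ] → a ≈ 0ℤ [mod p ] ⊎ b ≈ 0ℤ [mod p ]
  euclid a b ab≈0 with euclidsLemma ∣ a ∣ ∣ b ∣ p-prime (subst (p ℕ.∣_) (abs-* a b) (≈0⇒∣ ab≈0))
  ... | inj₁ p∣a = inj₁ (∣⇒≈0 p∣a)
  ... | inj₂ p∣b = inj₂ (∣⇒≈0 p∣b)

  Unit-* : ∀ {a b} → Unit a → Unit b → Unit (a * b)
  Unit-* {a} {b} ua ub ab≈0 with euclid a b ab≈0
  ... | inj₁ a≈0 = ua a≈0
  ... | inj₂ b≈0 = ub b≈0

  Unit-1 : Unit 1ℤ
  Unit-1 1≈0 = ℕ.<⇒≱ (ℕ.s≤s (ℕ.s≤s ℕ.z≤n)) (ℕ.∣⇒≤ (≈0⇒∣ 1≈0))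

  Unit-^ : ∀ {a} e → Unit a → Unit (a ^ e)
  Unit-^ zero    ua = Unit-1
  Unit-^ (suc e) ua = Unit-* ua (Unit-^ e ua)

  Unit-^-base : ∀ {a} e → Unit (a ^ suc e) → Unit a
  Unit-^-base {a} e ua^ a≈0 = ua^ (≈-trans (*-congʳ (a ^ e) a≈0) (≈-reflexive (*-zeroˡ (a ^ e))))

  Unit-resp : ∀ {a b} → a ≈ b [mod p ] → Unit a → Unit b
  Unit-resp a≈b ua b≈0 = ua (≈-trans a≈b b≈0)

  Unit-neg : ∀ {a} → Unit a → Unit (- a)
  Unit-neg {a} ua -a≈0 = ua (≈-trans (≈-reflexive (sym (neg-involutive a))) (neg-cong -a≈0))

  Unit-±1 : ∀ {ε} → ε ≡ 1ℤ ⊎ ε ≡ -1ℤ → Unit ε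
  Unit-±1 (inj₁ refl) = Unit-1
  Unit-±1 (inj₂ refl) = Unit-neg Unit-1

  inverse⇒Unit : ∀ {a} u → u * a ≈ 1ℤ [mod p ] → Unit a
  inverse⇒Unit {a} u ua≈1 a≈0 = Unit-1 (≈-trans (≈-sym ua≈1) (≈-trans (*-congˡ u a≈0) (≈-reflexive (*-zeroʳ u))))

  Unit-cancelˡ : ∀ {a x y} → Unit a → a * x ≈ a * y [mod p ] → x ≈ y [mod p ]
  Unit-cancelˡ {a} {x} {y} ua ax≈ay with euclid a (x - y) (≈-trans (≈-reflexive (factor a x y)) (≈⇒-≈0 ax≈ay))
    where
    factor : ∀ a x y → a * (x - y) ≡ a * x - a * y
    factor = solve-∀
  ... | inj₁ a≈0   = ⊥-elim (ua a≈0)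
  ... | inj₂ x-y≈0 = -≈0⇒≈ x-y≈0

  binomialSum-≈1 : ∀ x j → j ℕ.< p → binomialSum p x (suc j) ≈ 1ℤ [mod p ]
  binomialSum-≈1 x zero    _   = ≈-refl
  binomialSum-≈1 x (suc j) j<p =
    ≈-trans (+-cong (binomialSum-≈1 x j (ℕ.<⇒≤ j<p)) (*-congʳ (x ^ suc j) p∣C))
            (≈-reflexive (drop 1ℤ (x ^ suc j)))
    where
    p∣C : + (p C suc j) ≈ 0ℤ [mod p ]
    p∣C = ∣⇒≈0 (prime∣C (ℕ.s≤s ℕ.z≤n) j<p)
    drop : ∀ b y → b + 0ℤ * y ≡ b
    drop = solve-∀

  frobenius : ∀ x → (x + 1ℤ) ^ p ≈ x ^ p + 1ℤ [mod p ]
  frobenius x = begin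
    (x + 1ℤ) ^ p                              ≡⟨ binomial-theorem p x ⟩
    binomialSum p x p + + (p C p) * x ^ p     ≈⟨ +-congʳ _ (binomialSum-≈1 x (suc k) ℕ.≤-refl) ⟩
    1ℤ + + (p C p) * x ^ p                    ≡⟨ cong (λ c → 1ℤ + + c * x ^ p) (nCn≡1 p) ⟩
    1ℤ + 1ℤ * x ^ p                           ≡⟨ swap (x ^ p) ⟩
    x ^ p + 1ℤ                                ∎
    where
    open ≈-Reasoning
    swap : ∀ y → 1ℤ + 1ℤ * y ≡ y + 1ℤ
    swap = solve-∀

  fermat-ℕ : ∀ n → (+ n) ^ p ≈ + n [mod p ]
  fermat-ℕ zero    = ≈-refl
  fermat-ℕ (suc n) = begin
    (+ suc n) ^ p       ≡⟨ cong (λ z → z ^ p) +[1+n]≡+n+1 ⟩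
    (+ n + 1ℤ) ^ p      ≈⟨ frobenius (+ n) ⟩
    (+ n) ^ p + 1ℤ      ≈⟨ +-congʳ 1ℤ (fermat-ℕ n) ⟩
    + n + 1ℤ            ≡⟨ +[1+n]≡+n+1 ⟨
    + suc n             ∎
    where
    open ≈-Reasoning
    +[1+n]≡+n+1 : + suc n ≡ + n + 1ℤ
    +[1+n]≡+n+1 = trans (cong +_ (ℕ.+-comm 1 n)) (pos-+ n 1)

  fermat : ∀ a → a ^ p ≈ a [mod p ]
  fermat a = begin
    a ^ p           ≈⟨ ^-cong p (%ℕ≈ a p) ⟨
    (+ r) ^ p       ≈⟨ fermat-ℕ r ⟩
    + r             ≈⟨ %ℕ≈ a p ⟩
    a               ∎
    where
    open ≈-Reasoning
    r = a %ℕ p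

  fermat-unit : ∀ {a} → Unit a → a ^ suc k ≈ 1ℤ [mod p ]
  fermat-unit {a} ua = Unit-cancelˡ ua (≈-trans (fermat a) (≈-reflexive (sym (*-identityʳ a))))

  p² : ℕ
  p² = p ℕ.* p

  q : ℕ
  q = suc k

  L : ℕ
  L = p ℕ.* q

  euler : ∀ {a} → Unit a → a ^ L ≈ 1ℤ [mod p² ]
  euler {a} ua = begin
    a ^ L            ≡⟨ cong (a ^_) (ℕ.*-comm p q) ⟩
    a ^ (q ℕ.* p)    ≡⟨ ^-*-assoc a q p ⟨
    (a ^ q) ^ p      ≈⟨ ^-lift p (fermat-unit ua) ⟩
    1ℤ ^ p           ≡⟨ ^-zeroˡ p ⟩
    1ℤ               ∎
    where open ≈-Reasoning

  -- a ^ (L - 1), so that a * inverse a is a ^ L by definition.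
  inverse : ℤ → ℤ
  inverse a = a ^ (k ℕ.+ q ℕ.* q)

  *-inverse : ∀ {a} → Unit a → a * inverse a ≈ 1ℤ [mod p² ]
  *-inverse = euler

  inverse-* : ∀ {a} → Unit a → inverse a * a ≈ 1ℤ [mod p² ]
  inverse-* {a} ua = ≈-trans (≈-reflexive (*-comm (inverse a) a)) (euler ua)

  Unit-cancelˡ² : ∀ {a x y} → Unit a → a * x ≈ a * y [mod p² ] → x ≈ y [mod p² ]
  Unit-cancelˡ² {a} ua = inverse⇒cancelˡ {a = a} {u = inverse a} (inverse-* ua)

  ^-periodic : ∀ {a} → Unit a → ∀ e j → a ^ (e ℕ.+ j ℕ.* L) ≈ a ^ e [mod p² ]
  ^-periodic {a} ua e j = begin
    a ^ (e ℕ.+ j ℕ.* L)      ≡⟨ ^-distribˡ-+-* a e (j ℕ.* L) ⟩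
    a ^ e * a ^ (j ℕ.* L)    ≡⟨ cong (λ z → a ^ e * a ^ z) (ℕ.*-comm j L) ⟩
    a ^ e * a ^ (L ℕ.* j)    ≡⟨ cong (a ^ e *_) (^-*-assoc a L j) ⟨
    a ^ e * (a ^ L) ^ j      ≈⟨ *-congˡ (a ^ e) (^-cong j (euler ua)) ⟩
    a ^ e * 1ℤ ^ j           ≡⟨ cong (a ^ e *_) (^-zeroˡ j) ⟩
    a ^ e * 1ℤ               ≡⟨ *-identityʳ (a ^ e) ⟩
    a ^ e                    ∎
    where open ≈-Reasoning

  +-shift : ∀ e e′ j → + e ≡ + e′ + + j * + L → e ≡ e′ ℕ.+ j ℕ.* L
  +-shift e e′ j eq = +-injective (trans eq (trans (cong (λ z → + e′ + z) (sym (pos-* j L))) (sym (pos-+ e′ (j ℕ.* L)))))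

  ^-cong-exponent : ∀ {a} → Unit a → ∀ e e′ → + e ≈ + e′ [mod L ] → a ^ e ≈ a ^ e′ [mod p² ]
  ^-cong-exponent {a} ua e e′ (≈-by (+ j) eq) =
    subst (λ z → a ^ z ≈ a ^ e′ [mod p² ]) (sym (+-shift e e′ j eq)) (^-periodic ua e′ j)
  ^-cong-exponent {a} ua e e′ (≈-by -[1+ j ] eq) =
    ≈-sym (subst (λ z → a ^ z ≈ a ^ e [mod p² ]) (sym (+-shift e′ e (suc j) (flip eq))) (^-periodic ua e (suc j)))
    where
    flip : + e ≡ + e′ + - (+ suc j) * + L → + e′ ≡ + e + + suc j * + L
    flip eq = trans (cancel (+ e′) (+ suc j) (+ L)) (cong (λ z → z + + suc j * + L) (sym eq))
      where
      cancel : ∀ e′ c l → e′ ≡ (e′ + (- c) * l) + c * l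
      cancel = solve-∀

  infixr 8 _^ℤ_

  -- Exponents are reduced modulo L, which by euler does not change powers of units modulo p².
  _^ℤ_ : ℤ → ℤ → ℤ
  a ^ℤ e = a ^ (e %ℕ L)

  ^ℤ-cong : ∀ {a e e′} → Unit a → e ≈ e′ [mod L ] → a ^ℤ e ≈ a ^ℤ e′ [mod p² ]
  ^ℤ-cong {e = e} {e′} ua h = ^-cong-exponent ua _ _ (≈-trans (%ℕ≈ e L) (≈-trans h (≈-sym (%ℕ≈ e′ L))))

  ^ℤ-pos : ∀ {a} → Unit a → ∀ e → a ^ℤ + e ≈ a ^ e [mod p² ]
  ^ℤ-pos ua e = ^-cong-exponent ua _ e (%ℕ≈ (+ e) L)

  ^ℤ-+ : ∀ {a} → Unit a → ∀ e e′ → a ^ℤ e * a ^ℤ e′ ≈ a ^ℤ (e + e′) [mod p² ]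
  ^ℤ-+ {a} ua e e′ = ≈-trans (≈-reflexive (sym (^-distribˡ-+-* a (e %ℕ L) (e′ %ℕ L))))
    (^-cong-exponent ua _ _ (≈-trans (≈-reflexive (pos-+ (e %ℕ L) (e′ %ℕ L)))
                              (≈-trans (+-cong (%ℕ≈ e L) (%ℕ≈ e′ L)) (≈-sym (%ℕ≈ (e + e′) L)))))

  ^ℤ-inverse : ∀ {a} → Unit a → ∀ e → a ^ℤ (- e) * a ^ℤ e ≈ 1ℤ [mod p² ]
  ^ℤ-inverse {a} ua e = ≈-trans (^ℤ-+ ua (- e) e) (≈-reflexive (cong (a ^ℤ_) (+-inverseˡ e)))

  ^ℤ-negsuc : ∀ {a} u → Unit a → u * a ≈ 1ℤ [mod p² ] → ∀ j → a ^ℤ -[1+ j ] ≈ u ^ suc j [mod p² ]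
  ^ℤ-negsuc {a} u ua ua≈1 j = begin
    a ^ℤ e                                ≡⟨ *-identityʳ (a ^ℤ e) ⟨
    a ^ℤ e * 1ℤ                           ≡⟨ cong (a ^ℤ e *_) (^-zeroˡ (suc j)) ⟨
    a ^ℤ e * 1ℤ ^ suc j                   ≈⟨ *-congˡ (a ^ℤ e) (^-cong (suc j) ua≈1) ⟨
    a ^ℤ e * (u * a) ^ suc j              ≡⟨ cong (a ^ℤ e *_) (^-distribʳ-* u a (suc j)) ⟩
    a ^ℤ e * (u ^ suc j * a ^ suc j)      ≡⟨ x∙yz≈y∙xz (a ^ℤ e) (u ^ suc j) (a ^ suc j) ⟩
    u ^ suc j * (a ^ℤ e * a ^ suc j)      ≈⟨ *-congˡ (u ^ suc j) (*-congˡ (a ^ℤ e) (^ℤ-pos ua (suc j))) ⟨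
    u ^ suc j * (a ^ℤ e * a ^ℤ + suc j)   ≈⟨ *-congˡ (u ^ suc j) (^ℤ-inverse ua (+ suc j)) ⟩
    u ^ suc j * 1ℤ                        ≡⟨ *-identityʳ (u ^ suc j) ⟩
    u ^ suc j                             ∎
    where
    open ≈-Reasoning
    e = -[1+ j ]

  PowMod⇒^ℤ : ∀ {a e r} → Unit a → PowMod p² a e r → a ^ℤ e ≈ r [mod p² ]
  PowMod⇒^ℤ {a} {+ e}     {r} ua aᵉ≡r             = ≈-trans (^ℤ-pos ua e) (≡mod⇒≈ (a ^ e) r aᵉ≡r)
  PowMod⇒^ℤ {a} { -[1+ j ]} {r} ua (u , ua≡1 , uʲ≡r) =
    ≈-trans (^ℤ-negsuc u ua (≡mod⇒≈ (u * a) 1ℤ ua≡1) j) (≡mod⇒≈ (u ^ suc j) r uʲ≡r)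

  ^ℤ⇒PowMod : ∀ {a e r} → Unit a → a ^ℤ e ≈ r [mod p² ] → PowMod p² a e r
  ^ℤ⇒PowMod {e = + e}      ua h = ≈⇒≡mod (≈-trans (≈-sym (^ℤ-pos ua e)) h)
  ^ℤ⇒PowMod {a} { -[1+ j ]} ua h =
    inverse a , ≈⇒≡mod (inverse-* ua) , ≈⇒≡mod (≈-trans (≈-sym (^ℤ-negsuc (inverse a) ua (inverse-* ua) j)) h)

  PowMod-Unit-base : ∀ {c e s} → Unit e → Unit s → PowMod p² c e s → Unit c
  PowMod-Unit-base {e = + zero}      ue _  _         = ⊥-elim (ue ≈-refl)
  PowMod-Unit-base {c} {+ suc j} {s} _ us cʲ≡s      = Unit-^-base j (Unit-resp (≈-sym (≈-weakenˡ p p (≡mod⇒≈ (c ^ suc j) s cʲ≡s))) us)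
  PowMod-Unit-base {c} { -[1+ j ]} _ _ (u , uc≡1 , _) = inverse⇒Unit u (≈-weakenˡ p p (≡mod⇒≈ (u * c) 1ℤ uc≡1))

  PthPower : ℤ → Set
  PthPower x = ∃[ a ] x ≈ a ^ p [mod p² ]

  PthPower-Unit : ∀ {x} → Unit x → PthPower x → ∃[ a ] (Unit a × x ≈ a ^ p [mod p² ])
  PthPower-Unit ux (a , x≈aᵖ) = a , Unit-resp (≈-trans (≈-weakenˡ p p x≈aᵖ) (fermat a)) ux , x≈aᵖ

  PthPower^q : ∀ {x} → Unit x → PthPower x → x ^ q ≈ 1ℤ [mod p² ]
  PthPower^q {x} ux xᵖ with PthPower-Unit ux xᵖ
  ... | a , ua , x≈aᵖ = begin
    x ^ q           ≈⟨ ^-cong q x≈aᵖ ⟩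
    (a ^ p) ^ q     ≡⟨ ^-*-assoc a p q ⟩
    a ^ L           ≈⟨ euler ua ⟩
    1ℤ              ∎
    where open ≈-Reasoning

  PthPower-^ℤ-cong : ∀ {x e e′} → Unit x → PthPower x → e ≈ e′ [mod q ] → x ^ℤ e ≈ x ^ℤ e′ [mod p² ]
  PthPower-^ℤ-cong {x} {e′ = e′} ux xᵖ (≈-by t refl) = begin
    x ^ℤ (e′ + t * + q)               ≈⟨ ^ℤ-+ ux e′ (t * + q) ⟨
    x ^ℤ e′ * x ^ℤ (t * + q)          ≈⟨ *-congˡ (x ^ℤ e′) xᵗᑫ≈1 ⟩
    x ^ℤ e′ * 1ℤ                      ≡⟨ *-identityʳ (x ^ℤ e′) ⟩
    x ^ℤ e′                           ∎
    where
    open ≈-Reasoning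
    t′ = t %ℕ L
    xᵗᑫ≈1 : x ^ℤ (t * + q) ≈ 1ℤ [mod p² ]
    xᵗᑫ≈1 = begin
      x ^ℤ (t * + q)           ≈⟨ ^ℤ-cong ux (*-congʳ (+ q) (%ℕ≈ t L)) ⟨
      x ^ℤ (+ t′ * + q)        ≡⟨ cong (x ^ℤ_) (pos-* t′ q) ⟨
      x ^ℤ + (t′ ℕ.* q)        ≈⟨ ^ℤ-pos ux (t′ ℕ.* q) ⟩
      x ^ (t′ ℕ.* q)           ≡⟨ cong (x ^_) (ℕ.*-comm t′ q) ⟩
      x ^ (q ℕ.* t′)           ≡⟨ ^-*-assoc x q t′ ⟨
      (x ^ q) ^ t′             ≈⟨ ^-cong t′ (PthPower^q ux xᵖ) ⟩
      1ℤ ^ t′                  ≡⟨ ^-zeroˡ t′ ⟩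
      1ℤ                       ∎

  PthPower-unique : ∀ {x x′} → PthPower x → PthPower x′ → x ≈ x′ [mod p ] → x ≈ x′ [mod p² ]
  PthPower-unique (a , x≈aᵖ) (a′ , x′≈a′ᵖ) x≈x′ = ≈-trans x≈aᵖ (≈-trans (^-lift p a≈a′) (≈-sym x′≈a′ᵖ))
    where
    a≈a′ : a ≈ a′ [mod p ]
    a≈a′ = ≈-trans (≈-sym (fermat a)) (≈-trans (≈-sym (≈-weakenˡ p p x≈aᵖ))
             (≈-trans x≈x′ (≈-trans (≈-weakenˡ p p x′≈a′ᵖ) (fermat a′))))

  -- A ≡ zN and B ≡ (1-z)N modulo p² for z = A N⁻¹ ≡ x (mod p); critical-point trades z for x.
  D-factor : ∀ ε a b {x} → Unit (+ (suc a ℕ.+ suc b)) → + (suc a ℕ.+ suc b) * x ≈ + suc a [mod p ] →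
             D ε (suc a ℕ.+ suc b) (suc b) ≈
             (+ (suc a ℕ.+ suc b)) ^ (suc a ℕ.+ suc b) * (1ℤ + ε * (x ^ suc a * (1ℤ - x) ^ suc b)) [mod p² ]
  D-factor ε a b {x} uN Nx≈A = begin
    D ε Nℕ (suc b)                                      ≡⟨ D-pos ε a b ⟩
    N ^ Nℕ + ε * (A ^ suc a * B ^ suc b)                ≈⟨ +-congˡ (N ^ Nℕ) (*-congˡ ε (*-cong (^-cong (suc a) A≈zN) (^-cong (suc b) B≈[1-z]N))) ⟩
    N ^ Nℕ + ε * ((z * N) ^ suc a * ((1ℤ - z) * N) ^ suc b)
      ≡⟨ cong (λ u → N ^ Nℕ + ε * u) (trans (cong₂ _*_ (^-distribʳ-* z N (suc a)) (^-distribʳ-* (1ℤ - z) N (suc b)))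
                                            (interchange (z ^ suc a) ((1ℤ - z) ^ suc b) (N ^ suc a) (N ^ suc b))) ⟩
    N ^ Nℕ + ε * (g z * (N ^ suc a * N ^ suc b))        ≡⟨ cong (λ u → N ^ Nℕ + ε * (g z * u)) (^-distribˡ-+-* N (suc a) (suc b)) ⟨
    N ^ Nℕ + ε * (g z * N ^ Nℕ)                         ≈⟨ +-congˡ (N ^ Nℕ) (*-congˡ ε (*-congʳ (N ^ Nℕ) (critical-point p a b [A+B]x≈A z≈x))) ⟩
    N ^ Nℕ + ε * (g x * N ^ Nℕ)                         ≡⟨ factor ε (g x) (N ^ Nℕ) ⟩
    N ^ Nℕ * (1ℤ + ε * g x)                             ∎
    where
    open ≈-Reasoning
    Nℕ = suc a ℕ.+ suc b
    N = + Nℕ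
    A = + suc a
    B = + suc b
    g : ℤ → ℤ
    g y = y ^ suc a * (1ℤ - y) ^ suc b
    z = A * inverse N
    N≡A+B : N ≡ A + B
    N≡A+B = pos-+ (suc a) (suc b)
    [A+B]x≈A : (A + B) * x ≈ A [mod p ]
    [A+B]x≈A = subst (λ u → u * x ≈ A [mod p ]) N≡A+B Nx≈A
    A≈zN : A ≈ z * N [mod p² ]
    A≈zN = ≈-sym (≈-trans (≈-reflexive (*-assoc A (inverse N) N)) (≈-trans (*-congˡ A (inverse-* uN)) (≈-reflexive (*-identityʳ A))))
    B≈[1-z]N : B ≈ (1ℤ - z) * N [mod p² ]
    B≈[1-z]N = ≈-sym (≈-trans (≈-reflexive (distrib z N)) (≈-trans (-‿congˡ N (≈-sym A≈zN)) (≈-reflexive (trans (cong (_- A) N≡A+B) (cancel A B)))))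
      where
      distrib : ∀ z N → (1ℤ - z) * N ≡ N - z * N
      distrib = solve-∀
      cancel : ∀ A B → (A + B) - A ≡ B
      cancel = solve-∀
    z≈x : z ≈ x [mod p ]
    z≈x = ≈-trans (*-congʳ (inverse N) (≈-sym Nx≈A)) (≈-trans (≈-reflexive (*-comm (N * x) (inverse N)))
            (≈-trans (≈-reflexive (sym (*-assoc (inverse N) N x))) (≈-trans (*-congʳ x (≈-weakenˡ p p (inverse-* uN))) (≈-reflexive (*-identityˡ x)))))
    interchange : ∀ a b c d → (a * c) * (b * d) ≡ (a * b) * (c * d)
    interchange = solve-∀
    factor : ∀ ε g n → n + ε * (g * n) ≡ n * (1ℤ + ε * g)
    factor = solve-∀

  β : ℤ → ℤ → ℤ → ℤ
  β m e u = (m - e) * + p - m * u * + q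

  β≈mod-p : ∀ m e u → β m e u ≈ m * u [mod p ]
  β≈mod-p m e u = ≈-trans (≈-reflexive (regroup m e u (+ q))) (+-multiple≈ (m * u) ((m - e) - m * u))
    where
    regroup : ∀ m e u q → (m - e) * (1ℤ + q) - m * u * q ≡ m * u + ((m - e) - m * u) * (1ℤ + q)
    regroup = solve-∀

  β≈mod-q : ∀ m e u → β m e u ≈ m - e [mod q ]
  β≈mod-q m e u = ≈-trans (≈-reflexive (regroup m e u (+ q))) (+-multiple≈ (m - e) ((m - e) - m * u))
    where
    regroup : ∀ m e u q → (m - e) * (1ℤ + q) - m * u * q ≡ (m - e) + ((m - e) - m * u) * q
    regroup = solve-∀

  β-cong : ∀ m {e e′ u u′} → e ≈ e′ [mod q ] → u ≈ u′ [mod p² ] → β m e u ≈ β m e′ u′ [mod L ]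
  β-cong m {e′ = e′} {u′ = u′} (≈-by t refl) (≈-by r refl) =
    ≈-by (- t - m * r * + p)
      (trans (cong (λ z → (m - (e′ + t * + q)) * + p - m * (u′ + r * z) * + q) (pos-* p p))
      (trans (regroup m e′ u′ t r (+ p) (+ q)) (cong (λ z → β m e′ u′ + (- t - m * r * + p) * z) (sym (pos-* p q)))))
    where
    regroup : ∀ m e′ u′ t r p q → (m - (e′ + t * q)) * p - m * (u′ + r * (p * p)) * q
                                  ≡ ((m - e′) * p - m * u′ * q) + (- t - m * r * p) * (p * q)
    regroup = solve-∀

  module Correspondence (m : ℤ) (um : Unit m) (ε : ℤ) (±1 : ε ≡ 1ℤ ⊎ ε ≡ -1ℤ) where

    open Sign {ε} (±1² ±1)

    PowerRelation : ℤ → ℤ → Set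
    PowerRelation x e = x ^ℤ e ≈ - ε * (1ℤ - x) ^ℤ m [mod p² ]

    D≈0⇒ : ∀ a b {x} → Unit (+ (suc a ℕ.+ suc b)) → + (suc a ℕ.+ suc b) * x ≈ + suc a [mod p ] →
           D ε (suc a ℕ.+ suc b) (suc b) ≈ 0ℤ [mod p² ] → x ^ suc a * (1ℤ - x) ^ suc b ≈ - ε [mod p² ]
    D≈0⇒ a b {x} uN Nx≈A D≈0 = 1+ε*≈0⇒≈-ε (Unit-cancelˡ² (Unit-^ (suc a ℕ.+ suc b) uN)
      (≈-trans (≈-sym (D-factor ε a b uN Nx≈A)) (≈-trans D≈0 (≈-reflexive (sym (*-zeroʳ Nᴺ))))))
      where Nᴺ = (+ (suc a ℕ.+ suc b)) ^ (suc a ℕ.+ suc b)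

    ⇒D≈0 : ∀ a b {x} → Unit (+ (suc a ℕ.+ suc b)) → + (suc a ℕ.+ suc b) * x ≈ + suc a [mod p ] →
           x ^ suc a * (1ℤ - x) ^ suc b ≈ - ε [mod p² ] → D ε (suc a ℕ.+ suc b) (suc b) ≈ 0ℤ [mod p² ]
    ⇒D≈0 a b {x} uN Nx≈A g≈-ε = ≈-trans (D-factor ε a b uN Nx≈A)
      (≈-trans (*-congˡ Nᴺ (≈-ε⇒1+ε*≈0 g≈-ε)) (≈-reflexive (*-zeroʳ Nᴺ)))
      where Nᴺ = (+ (suc a ℕ.+ suc b)) ^ (suc a ℕ.+ suc b)

    module Exponents {x e : ℤ} {a b : ℕ} (ux : Unit x) (xᵖ : PthPower x) (u1-x : Unit (1ℤ - x))
                     (e+A≈0 : e + + suc a ≈ 0ℤ [mod q ]) (B≈m : + suc b ≈ m [mod L ]) where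

      xᵉxᴬ≈1 : x ^ℤ e * x ^ suc a ≈ 1ℤ [mod p² ]
      xᵉxᴬ≈1 = begin
        x ^ℤ e * x ^ suc a          ≈⟨ *-congˡ (x ^ℤ e) (^ℤ-pos ux (suc a)) ⟨
        x ^ℤ e * x ^ℤ + suc a       ≈⟨ *-congˡ (x ^ℤ e) (PthPower-^ℤ-cong ux xᵖ A≈-e) ⟩
        x ^ℤ e * x ^ℤ (- e)         ≡⟨ *-comm (x ^ℤ e) (x ^ℤ (- e)) ⟩
        x ^ℤ (- e) * x ^ℤ e         ≈⟨ ^ℤ-inverse ux e ⟩
        1ℤ                          ∎
        where
        open ≈-Reasoning
        A≈-e : + suc a ≈ - e [mod q ]
        A≈-e = ≈-trans (≈-reflexive (isolate e (+ suc a))) (≈-trans (+-congʳ (- e) e+A≈0) (≈-reflexive (+-identityˡ (- e))))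
          where
          isolate : ∀ e A → A ≡ (e + A) - e
          isolate = solve-∀

      [1-x]ᴮ≈ : (1ℤ - x) ^ suc b ≈ (1ℤ - x) ^ℤ m [mod p² ]
      [1-x]ᴮ≈ = ≈-trans (≈-sym (^ℤ-pos u1-x (suc b))) (^ℤ-cong u1-x B≈m)

      ⇒PowerRelation : x ^ suc a * (1ℤ - x) ^ suc b ≈ - ε [mod p² ] → PowerRelation x e
      ⇒PowerRelation g≈-ε = begin
        x ^ℤ e                              ≡⟨ *-identityʳ (x ^ℤ e) ⟨
        x ^ℤ e * 1ℤ                         ≡⟨ cong (x ^ℤ e *_) -ε²≡1 ⟨
        x ^ℤ e * (- ε * - ε)                ≈⟨ *-congˡ (x ^ℤ e) (*-congˡ (- ε) g≈-ε) ⟨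
        x ^ℤ e * (- ε * (X * W))            ≡⟨ rearrange (x ^ℤ e) (- ε) X W ⟩
        (- ε * W) * (x ^ℤ e * X)            ≈⟨ *-congˡ (- ε * W) xᵉxᴬ≈1 ⟩
        (- ε * W) * 1ℤ                      ≡⟨ *-identityʳ (- ε * W) ⟩
        - ε * W                             ≈⟨ *-congˡ (- ε) [1-x]ᴮ≈ ⟩
        - ε * (1ℤ - x) ^ℤ m                 ∎
        where
        open ≈-Reasoning
        X = x ^ suc a
        W = (1ℤ - x) ^ suc b
        rearrange : ∀ r c X W → r * (c * (X * W)) ≡ (c * W) * (r * X)
        rearrange = solve-∀

      PowerRelation⇒ : PowerRelation x e → x ^ suc a * (1ℤ - x) ^ suc b ≈ - ε [mod p² ]
      PowerRelation⇒ rel = begin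
        X * W                               ≈⟨ *-congˡ X [1-x]ᴮ≈ ⟩
        X * S                               ≡⟨ cong (X *_) (*-identityˡ S) ⟨
        X * (1ℤ * S)                        ≡⟨ cong (λ c → X * (c * S)) -ε²≡1 ⟨
        X * (- ε * - ε * S)                 ≡⟨ cong (X *_) (*-assoc (- ε) (- ε) S) ⟩
        X * (- ε * (- ε * S))               ≈⟨ *-congˡ X (*-congˡ (- ε) rel) ⟨
        X * (- ε * x ^ℤ e)                  ≡⟨ x∙yz≈y∙xz X (- ε) (x ^ℤ e) ⟩
        - ε * (X * x ^ℤ e)                  ≡⟨ cong (- ε *_) (*-comm X (x ^ℤ e)) ⟩
        - ε * (x ^ℤ e * X)                  ≈⟨ *-congˡ (- ε) xᵉxᴬ≈1 ⟩
        - ε * 1ℤ                            ≡⟨ *-identityʳ (- ε) ⟩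
        - ε                                 ∎
        where
        open ≈-Reasoning
        X = x ^ suc a
        W = (1ℤ - x) ^ suc b
        S = (1ℤ - x) ^ℤ m

    D≈0⇒N-Unit : ∀ a b → D ε (suc a ℕ.+ suc b) (suc b) ≈ 0ℤ [mod p ] → Unit (+ suc b) → Unit (+ (suc a ℕ.+ suc b))
    D≈0⇒N-Unit a b D≈0 uB N≈0 = Unit-* (Unit-±1 ±1) (Unit-* (Unit-^ (suc a) uA) (Unit-^ (suc b) uB)) εAᴬBᴮ≈0
      where
      N = + (suc a ℕ.+ suc b)
      A = + suc a
      B = + suc b
      AᴬBᴮ = A ^ suc a * B ^ suc b
      uA : Unit A
      uA = Unit-resp (≈-sym A≈-B) (Unit-neg uB)
        where
        A≈-B : A ≈ - B [mod p ]
        A≈-B = ≈-trans (≈-reflexive (trans (isolate A B) (cong (_- B) (sym (pos-+ (suc a) (suc b))))))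
                       (≈-trans (+-congʳ (- B) N≈0) (≈-reflexive (+-identityˡ (- B))))
          where
          isolate : ∀ A B → A ≡ (A + B) - B
          isolate = solve-∀
      εAᴬBᴮ≈0 : ε * AᴬBᴮ ≈ 0ℤ [mod p ]
      εAᴬBᴮ≈0 = begin
        ε * AᴬBᴮ                              ≡⟨ +-identityˡ (ε * AᴬBᴮ) ⟨
        0ℤ + ε * AᴬBᴮ                         ≈⟨ +-congʳ (ε * AᴬBᴮ) (*-congʳ (N ^ (a ℕ.+ suc b)) N≈0) ⟨
        N ^ (suc a ℕ.+ suc b) + ε * AᴬBᴮ      ≡⟨ D-pos ε a b ⟨
        D ε (suc a ℕ.+ suc b) (suc b)         ≈⟨ D≈0 ⟩
        0ℤ                                    ∎
        where open ≈-Reasoning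

    D≈0⇒A-Unit : ∀ a b → D ε (suc a ℕ.+ suc b) (suc b) ≈ 0ℤ [mod p² ] → Unit (+ (suc a ℕ.+ suc b)) → Unit (+ suc a)
    D≈0⇒A-Unit zero    b _   _  = Unit-1
    D≈0⇒A-Unit (suc a) b D≈0 uN A≈0 = Unit-^ Nℕ uN (≈-weakenˡ p p Nᴺ≈0)
      where
      Nℕ = suc (suc a) ℕ.+ suc b
      N = + Nℕ
      A = + suc (suc a)
      Bᴮ = (+ suc b) ^ suc b
      Nᴺ≈0 : N ^ Nℕ ≈ 0ℤ [mod p² ]
      Nᴺ≈0 = begin
        N ^ Nℕ                           ≡⟨ vanish (N ^ Nℕ) ε Bᴮ ⟨
        N ^ Nℕ + ε * (0ℤ * Bᴮ)           ≈⟨ +-congˡ (N ^ Nℕ) (*-congˡ ε (*-congʳ Bᴮ (≈0⇒^≈0 a A≈0))) ⟨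
        N ^ Nℕ + ε * (A ^ suc (suc a) * Bᴮ) ≡⟨ D-pos ε (suc a) b ⟨
        D ε Nℕ (suc b)                   ≈⟨ D≈0 ⟩
        0ℤ                               ∎
        where
        open ≈-Reasoning
        vanish : ∀ n ε b → n + ε * (0ℤ * b) ≡ n
        vanish = solve-∀

    α-image : ∀ n a b → + (suc a ℕ.+ suc b) ≈ n [mod L ] → + suc b ≈ m [mod L ] →
              D ε (suc a ℕ.+ suc b) (suc b) ≈ 0ℤ [mod p² ] →
              ∃[ x ] ∃[ e ] (AlphaGraph p m n x e × InB p m ε x e)
    α-image n a b N≈n B≈m D≈0 =
      x , e , (x∈P , v , (≈⇒≡mod vn≈1 , ≈⇒≡mod x≈1-mv) , ≈⇒≡mod (≈-refl {a = e})) ,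
              (x∈P , x ^ℤ e , (1ℤ - x) ^ℤ m , ^ℤ⇒PowMod ux ≈-refl , ^ℤ⇒PowMod u1-x ≈-refl , ≈⇒≡mod relation)
      where
      N = + (suc a ℕ.+ suc b)
      A = + suc a
      B = + suc b
      N≡A+B : N ≡ A + B
      N≡A+B = pos-+ (suc a) (suc b)
      uB = Unit-resp (≈-sym (≈-weakenˡ p q B≈m)) um
      uN = D≈0⇒N-Unit a b (≈-weakenˡ p p D≈0) uB
      uA = D≈0⇒A-Unit a b D≈0 uN
      v = inverse N
      vN≈1 = ≈-weakenˡ p p (inverse-* uN)
      uv = inverse⇒Unit N (≈-weakenˡ p p (*-inverse uN))
      y = A * v
      x = y ^ p
      e = m - n
      ux = Unit-^ p (Unit-* uA uv)
      x∈P : NonzeroPthPower p x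
      x∈P = Unit⇒∣ ux , y , ≈⇒≡mod (≈-refl {a = x})
      vn≈1 : v * n ≈ 1ℤ [mod p ]
      vn≈1 = ≈-trans (*-congˡ v (≈-sym (≈-weakenˡ p q N≈n))) vN≈1
      1-x≈Bv : 1ℤ - x ≈ B * v [mod p ]
      1-x≈Bv = ≈-trans (-‿congˡ 1ℤ (fermat y)) (≈-trans (+-congʳ (- y) (≈-sym vN≈1))
                 (≈-reflexive (trans (cong (λ z → v * z - A * v) N≡A+B) (cancel v A B))))
        where
        cancel : ∀ v A B → v * (A + B) - A * v ≡ B * v
        cancel = solve-∀
      x≈1-mv : x ≈ 1ℤ - m * v [mod p ]
      x≈1-mv = ≈-trans (≈-reflexive (sym (double-neg x))) (-‿congˡ 1ℤ (≈-trans 1-x≈Bv (*-congʳ v (≈-weakenˡ p q B≈m))))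
        where
        double-neg : ∀ x → 1ℤ - (1ℤ - x) ≡ x
        double-neg = solve-∀
      u1-x = Unit-resp (≈-sym 1-x≈Bv) (Unit-* uB uv)
      Nx≈A : N * x ≈ A [mod p ]
      Nx≈A = ≈-trans (*-congˡ N (fermat y)) (≈-trans (≈-reflexive (x∙yz≈y∙xz N A v))
               (≈-trans (*-congˡ A (≈-trans (≈-reflexive (*-comm N v)) vN≈1)) (≈-reflexive (*-identityʳ A))))
      e+A≈0 : e + A ≈ 0ℤ [mod q ]
      e+A≈0 = ≈-weakenʳ p q (≈-trans (+-congʳ A (-‿cong (≈-sym B≈m) (≈-sym N≈n)))
                (≈-reflexive (trans (cong (λ z → (B - z) + A) N≡A+B) (cancel A B))))
        where
        cancel : ∀ A B → (B - (A + B)) + A ≡ 0ℤ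
        cancel = solve-∀
      relation : PowerRelation x e
      relation = Exponents.⇒PowerRelation {x} {e} {a} {b} ux (y , ≈-refl) u1-x e+A≈0 B≈m (D≈0⇒ a b uN Nx≈A D≈0)

    α-total : ∀ n → InA p m ε n → ∃[ x ] ∃[ e ] (AlphaGraph p m n x e × InB p m ε x e)
    α-total n (N , M , 0<M , M<N , N≡n , M≡m , p²∣D) with positive-split 0<M M<N
    ... | a , b , refl , refl = α-image n a b (≡mod⇒≈ _ n N≡n) (≡mod⇒≈ _ m M≡m) (∣⇒≈0 p²∣D)

    0<m%L : 0 ℕ.< m %ℕ L
    0<m%L with m %ℕ L | %ℕ≈ m L
    ... | zero  | 0≈m = ⊥-elim (um (≈-weakenˡ p q (≈-sym 0≈m)))
    ... | suc _ | _   = ℕ.s≤s ℕ.z≤n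

    %ℕ+L≈ : ∀ n → + (n %ℕ L ℕ.+ L) ≈ n [mod L ]
    %ℕ+L≈ n = ≈-trans (≈-reflexive (trans (pos-+ (n %ℕ L) L) (cong (λ z → + (n %ℕ L) + z) (sym (*-identityˡ (+ L))))))
                      (≈-trans (+-multiple≈ (+ (n %ℕ L)) 1ℤ) (%ℕ≈ n L))

    InA-intro : ∀ n → (∀ a b → + (suc a ℕ.+ suc b) ≈ n [mod L ] → + suc b ≈ m [mod L ] →
                       D ε (suc a ℕ.+ suc b) (suc b) ≈ 0ℤ [mod p² ]) → InA p m ε n
    InA-intro n D≈0 = representatives (n %ℕ L ℕ.+ L) (m %ℕ L) 0<m%L
                        (ℕ.<-≤-trans (n%ℕd<d m L) (ℕ.m≤n+m L (n %ℕ L))) (%ℕ+L≈ n) (%ℕ≈ m L)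
      where
      representatives : ∀ N M → 0 ℕ.< M → M ℕ.< N → + N ≈ n [mod L ] → + M ≈ m [mod L ] → InA p m ε n
      representatives N M 0<M M<N N≈n M≈m with positive-split 0<M M<N
      ... | a , b , refl , refl = N , M , 0<M , M<N , ≈⇒≡mod N≈n , ≈⇒≡mod M≈m , ≈0⇒∣ (D≈0 a b N≈n M≈m)

    β-image-D≈0 : ∀ {x e} → Unit x → PthPower x → Unit (1ℤ - x) → PowerRelation x e →
                  ∀ a b → + (suc a ℕ.+ suc b) ≈ β m e (inverse (1ℤ - x)) [mod L ] → + suc b ≈ m [mod L ] →
                  D ε (suc a ℕ.+ suc b) (suc b) ≈ 0ℤ [mod p² ]
    β-image-D≈0 {x} {e} ux xᵖ u1-x rel a b N≈n B≈m =
      ⇒D≈0 a b uN Nx≈A (Exponents.PowerRelation⇒ {x} {e} {a} {b} ux xᵖ u1-x e+A≈0 B≈m rel)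
      where
      N = + (suc a ℕ.+ suc b)
      A = + suc a
      B = + suc b
      u = inverse (1ℤ - x)
      A≡N-B : A ≡ N - B
      A≡N-B = trans (isolate A B) (cong (_- B) (sym (pos-+ (suc a) (suc b))))
        where
        isolate : ∀ A B → A ≡ (A + B) - B
        isolate = solve-∀
      N≈mu : N ≈ m * u [mod p ]
      N≈mu = ≈-trans (≈-weakenˡ p q N≈n) (β≈mod-p m e u)
      uN = Unit-resp (≈-sym N≈mu) (Unit-* um (inverse⇒Unit (1ℤ - x) (≈-weakenˡ p p (*-inverse u1-x))))
      Nx≈A : N * x ≈ A [mod p ]
      Nx≈A = begin
        N * x                     ≡⟨ complement N x ⟩
        N - N * (1ℤ - x)          ≈⟨ -‿congˡ N (*-congʳ (1ℤ - x) N≈mu) ⟩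
        N - m * u * (1ℤ - x)      ≡⟨ cong (λ z → N - z) (*-assoc m u (1ℤ - x)) ⟩
        N - m * (u * (1ℤ - x))    ≈⟨ -‿congˡ N (*-congˡ m (≈-weakenˡ p p (inverse-* u1-x))) ⟩
        N - m * 1ℤ                ≡⟨ cong (λ z → N - z) (*-identityʳ m) ⟩
        N - m                     ≈⟨ -‿congˡ N (≈-weakenˡ p q B≈m) ⟨
        N - B                     ≡⟨ A≡N-B ⟨
        A                         ∎
        where
        open ≈-Reasoning
        complement : ∀ N x → N * x ≡ N - N * (1ℤ - x)
        complement = solve-∀
      e+A≈0 : e + A ≈ 0ℤ [mod q ]
      e+A≈0 = ≈-trans (+-congˡ e (≈-trans (≈-reflexive A≡N-B)
                (-‿cong (≈-trans (≈-weakenʳ p q N≈n) (β≈mod-q m e u)) (≈-weakenʳ p q B≈m))))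
                (≈-reflexive (cancel e m))
        where
        cancel : ∀ e m → e + ((m - e) - m) ≡ 0ℤ
        cancel = solve-∀

    β-total : ∀ x e → InB p m ε x e → ∃[ n ] (BetaGraph p m x e n × InA p m ε n)
    β-total x e ((p∤x , a , x≡aᵖ) , r , s , xᵉ≡r , [1-x]ᵐ≡s , r≡-εs) =
      β m e u , (u , ≈⇒≡mod (inverse-* u1-x) , ≈⇒≡mod (≈-refl {a = β m e u})) ,
      InA-intro (β m e u) (β-image-D≈0 ux (a , ≡mod⇒≈ x (a ^ p) x≡aᵖ) u1-x relation)
      where
      ux = ∣⇒Unit p∤x
      xᵉ≈-εs : x ^ℤ e ≈ - ε * s [mod p² ]
      xᵉ≈-εs = ≈-trans (PowMod⇒^ℤ ux xᵉ≡r) (≡mod⇒≈ r (- ε * s) r≡-εs)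
      us : Unit s
      us s≈0 = Unit-^ (e %ℕ L) ux (≈-trans (≈-weakenˡ p p xᵉ≈-εs) (≈-trans (*-congˡ (- ε) s≈0) (≈-reflexive (*-zeroʳ (- ε)))))
      u1-x = PowMod-Unit-base um us [1-x]ᵐ≡s
      u = inverse (1ℤ - x)
      relation : PowerRelation x e
      relation = ≈-trans xᵉ≈-εs (*-congˡ (- ε) (≈-sym (PowMod⇒^ℤ u1-x [1-x]ᵐ≡s)))

    α-unique : ∀ n n′ x e x′ e′ → n ≡ n′ [mod L ] → AlphaGraph p m n x e → AlphaGraph p m n′ x′ e′ →
               (x ≡ x′ [mod p² ]) × (e ≡ e′ [mod q ])
    α-unique n n′ x e x′ e′ n≡n′ ((_ , a , x≡aᵖ) , v , (vn≡1 , x≡1-mv) , e≡m-n) ((_ , a′ , x′≡a′ᵖ) , v′ , (v′n′≡1 , x′≡1-mv′) , e′≡m-n′) =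
      ≈⇒≡mod (PthPower-unique (a , ≡mod⇒≈ x (a ^ p) x≡aᵖ) (a′ , ≡mod⇒≈ x′ (a′ ^ p) x′≡a′ᵖ) x≈x′) ,
      ≈⇒≡mod (≈-trans (≡mod⇒≈ e (m - n) e≡m-n) (≈-trans (-‿congˡ m (≈-weakenʳ p q n≈n′)) (≈-sym (≡mod⇒≈ e′ (m - n′) e′≡m-n′))))
      where
      n≈n′ = ≡mod⇒≈ n n′ n≡n′
      vn≈1 = ≡mod⇒≈ (v * n) 1ℤ vn≡1
      v≈v′ : v ≈ v′ [mod p ]
      v≈v′ = Unit-cancelˡ (inverse⇒Unit v vn≈1) (begin
        n * v       ≡⟨ *-comm n v ⟩
        v * n       ≈⟨ vn≈1 ⟩
        1ℤ          ≈⟨ ≡mod⇒≈ (v′ * n′) 1ℤ v′n′≡1 ⟨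
        v′ * n′     ≈⟨ *-congˡ v′ (≈-weakenˡ p q n≈n′) ⟨
        v′ * n      ≡⟨ *-comm v′ n ⟩
        n * v′      ∎)
        where open ≈-Reasoning
      x≈x′ : x ≈ x′ [mod p ]
      x≈x′ = ≈-trans (≡mod⇒≈ x (1ℤ - m * v) x≡1-mv)
               (≈-trans (-‿congˡ 1ℤ (*-congˡ m v≈v′)) (≈-sym (≡mod⇒≈ x′ (1ℤ - m * v′) x′≡1-mv′)))

    β-unique : ∀ x e x′ e′ n n′ → x ≡ x′ [mod p² ] → e ≡ e′ [mod q ] →
               BetaGraph p m x e n → BetaGraph p m x′ e′ n′ → n ≡ n′ [mod L ]
    β-unique x e x′ e′ n n′ x≡x′ e≡e′ (u , u[1-x]≡1 , n≡β) (u′ , u′[1-x′]≡1 , n′≡β′) =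
      ≈⇒≡mod (≈-trans (≡mod⇒≈ n (β m e u) n≡β)
               (≈-trans (β-cong m (≡mod⇒≈ e e′ e≡e′) u≈u′) (≈-sym (≡mod⇒≈ n′ (β m e′ u′) n′≡β′))))
      where
      u[1-x]≈1 = ≡mod⇒≈ (u * (1ℤ - x)) 1ℤ u[1-x]≡1
      u≈u′ : u ≈ u′ [mod p² ]
      u≈u′ = Unit-cancelˡ² (inverse⇒Unit u (≈-weakenˡ p p u[1-x]≈1)) (begin
        (1ℤ - x) * u       ≡⟨ *-comm (1ℤ - x) u ⟩
        u * (1ℤ - x)       ≈⟨ u[1-x]≈1 ⟩
        1ℤ                 ≈⟨ ≡mod⇒≈ (u′ * (1ℤ - x′)) 1ℤ u′[1-x′]≡1 ⟨
        u′ * (1ℤ - x′)     ≈⟨ *-congˡ u′ (-‿congˡ 1ℤ (≡mod⇒≈ x x′ x≡x′)) ⟨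
        u′ * (1ℤ - x)      ≡⟨ *-comm u′ (1ℤ - x) ⟩
        (1ℤ - x) * u′      ∎)
        where open ≈-Reasoning

    β∘α : ∀ n x e → AlphaGraph p m n x e → BetaGraph p m x e n
    β∘α n x e (_ , v , (vn≡1 , x≡1-mv) , e≡m-n) =
      u , ≈⇒≡mod (inverse-* u1-x) , ≈⇒≡mod (≈-combine q n≈β-mod-p n≈β-mod-q)
      where
      vn≈1 = ≡mod⇒≈ (v * n) 1ℤ vn≡1
      uv = inverse⇒Unit n (≈-trans (≈-reflexive (*-comm n v)) vn≈1)
      1-x≈mv : 1ℤ - x ≈ m * v [mod p ]
      1-x≈mv = ≈-trans (-‿congˡ 1ℤ (≡mod⇒≈ x (1ℤ - m * v) x≡1-mv)) (≈-reflexive (double-neg (m * v)))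
        where
        double-neg : ∀ y → 1ℤ - (1ℤ - y) ≡ y
        double-neg = solve-∀
      u1-x = Unit-resp (≈-sym 1-x≈mv) (Unit-* um uv)
      u = inverse (1ℤ - x)
      n≈β-mod-p : n ≈ β m e u [mod p ]
      n≈β-mod-p = ≈-trans (Unit-cancelˡ uv (begin
        v * n              ≈⟨ vn≈1 ⟩
        1ℤ                 ≈⟨ ≈-weakenˡ p p (inverse-* u1-x) ⟨
        u * (1ℤ - x)       ≈⟨ *-congˡ u 1-x≈mv ⟩
        u * (m * v)        ≡⟨ rotate u m v ⟩
        v * (m * u)        ∎)) (≈-sym (β≈mod-p m e u))
        where
        open ≈-Reasoning
        rotate : ∀ u m v → u * (m * v) ≡ v * (m * u)
        rotate = solve-∀
      n≈β-mod-q : n ≈ β m e u [mod q ]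
      n≈β-mod-q = ≈-trans (≈-reflexive (sym (double-neg m n)))
                    (≈-trans (-‿congˡ m (≈-sym (≡mod⇒≈ e (m - n) e≡m-n))) (≈-sym (β≈mod-q m e u)))
        where
        double-neg : ∀ m n → m - (m - n) ≡ n
        double-neg = solve-∀

    α∘β : ∀ x e n → NonzeroPthPower p x → BetaGraph p m x e n → AlphaGraph p m n x e
    α∘β x e n x∈P (u , u[1-x]≡1 , n≡β) = x∈P , v , (≈⇒≡mod vn≈1 , ≈⇒≡mod x≈1-mv) , ≈⇒≡mod e≈m-n
      where
      m⁻¹ = m ^ k
      mm⁻¹≈1 : m * m⁻¹ ≈ 1ℤ [mod p ]
      mm⁻¹≈1 = fermat-unit um
      v = (1ℤ - x) * m⁻¹
      n≈β = ≡mod⇒≈ n (β m e u) n≡β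
      vn≈1 : v * n ≈ 1ℤ [mod p ]
      vn≈1 = begin
        v * n                            ≈⟨ *-congˡ v (≈-trans (≈-weakenˡ p q n≈β) (β≈mod-p m e u)) ⟩
        (1ℤ - x) * m⁻¹ * (m * u)         ≡⟨ rearrange (1ℤ - x) m⁻¹ m u ⟩
        (u * (1ℤ - x)) * (m * m⁻¹)       ≈⟨ *-cong (≈-weakenˡ p p (≡mod⇒≈ (u * (1ℤ - x)) 1ℤ u[1-x]≡1)) mm⁻¹≈1 ⟩
        1ℤ * 1ℤ                          ≡⟨⟩
        1ℤ                               ∎
        where
        open ≈-Reasoning
        rearrange : ∀ w i m u → w * i * (m * u) ≡ (u * w) * (m * i)
        rearrange = solve-∀
      x≈1-mv : x ≈ 1ℤ - m * v [mod p ]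
      x≈1-mv = ≈-sym (begin
        1ℤ - m * ((1ℤ - x) * m⁻¹)        ≡⟨ cong (λ z → 1ℤ - z) (x∙yz≈y∙xz m (1ℤ - x) m⁻¹) ⟩
        1ℤ - (1ℤ - x) * (m * m⁻¹)        ≈⟨ -‿congˡ 1ℤ (*-congˡ (1ℤ - x) mm⁻¹≈1) ⟩
        1ℤ - (1ℤ - x) * 1ℤ               ≡⟨ double-neg x ⟩
        x                                ∎)
        where
        open ≈-Reasoning
        double-neg : ∀ x → 1ℤ - (1ℤ - x) * 1ℤ ≡ x
        double-neg = solve-∀
      e≈m-n : e ≈ m - n [mod q ]
      e≈m-n = ≈-trans (≈-reflexive (sym (double-neg m e)))
                (-‿congˡ m (≈-sym (≈-trans (≈-weakenʳ p q n≈β) (β≈mod-q m e u))))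
        where
        double-neg : ∀ m e → m - (m - e) ≡ e
        double-neg = solve-∀

theorem3p6 : (p : ℕ) → Prime p → ¬ (p ≡ 2) → (m : ℤ) → ¬ (+ p ∣ m) →
  (ε : ℤ) → (ε ≡ + 1 ⊎ ε ≡ - (+ 1)) →
    -- α is well defined: 𝒜 → ℬ
    ((n : ℤ) → InA p m ε n → ∃[ x ] ∃[ k ] (AlphaGraph p m n x k × InB p m ε x k))
    × ((n n' x k x' k' : ℤ) → InA p m ε n → n ≡ n' [mod p ℕ.* (p ℕ.∸ 1) ] →
         AlphaGraph p m n x k → AlphaGraph p m n' x' k' →
         (x ≡ x' [mod p ℕ.* p ]) × (k ≡ k' [mod p ℕ.∸ 1 ]))
    -- β is well defined: ℬ → 𝒜
    × ((x k : ℤ) → InB p m ε x k → ∃[ n ] (BetaGraph p m x k n × InA p m ε n))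
    × ((x k x' k' n n' : ℤ) → InB p m ε x k →
         x ≡ x' [mod p ℕ.* p ] → k ≡ k' [mod p ℕ.∸ 1 ] →
         BetaGraph p m x k n → BetaGraph p m x' k' n' →
         n ≡ n' [mod p ℕ.* (p ℕ.∸ 1) ])
    -- β ∘ α = id on 𝒜
    × ((n x k : ℤ) → InA p m ε n → AlphaGraph p m n x k → BetaGraph p m x k n)
    -- α ∘ β = id on ℬ
    × ((x k n : ℤ) → InB p m ε x k → BetaGraph p m x k n → AlphaGraph p m n x k)
-- The argument does not use that p is odd.
theorem3p6 p p-prime _ m p∤m ε ±1 with nonTrivial⇒n>1 p {{prime⇒nonTrivial p-prime}}
... | ℕ.s≤s (ℕ.s≤s (ℕ.z≤n {k})) =
  α-total , (λ n n′ x e x′ e′ _ → α-unique n n′ x e x′ e′) ,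
  β-total , (λ x e x′ e′ n n′ _ → β-unique x e x′ e′ n n′) ,
  (λ n x e _ → β∘α n x e) , (λ x e n (x∈P , _) → α∘β x e n x∈P)
  where
  open ModPrime k p-prime
  open Correspondence m (∣⇒Unit p∤m) ε ±1
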